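{- Let $\{c_k\}_{k\ge0}$ be any sequence of complex numbers and let $d_n=\sum_{k=0}^n\binom{n}{k}(-1)^{n-k}c_k$ for $n\ge0$ (equivalently $c_n=\sum_{k=0}^n\binom{n}{k}d_k$). Then for every integer $n\ge1$, $$\sum_{k=0}^n\binom{n}{k}(-1)^{k-1}H_kc_k=(-1)^{n-1}H_nd_n+\sum_{m=0}^{n-1}\frac{(-1)^md_m}{n-m}.$$
   Context: $H_n=1+\frac12+\cdots+\frac1n$ denotes the $n$-th harmonic number, with $H_0=0$. -}

module Defs where

open import Level using (Level)
open import Data.Nat using (ℕ; zero; suc; _∸_)
open import Data.Nat.Combinatorics using (_C_)
open import Data.Integer using (+_)
open import Data.Rational using (ℚ; _/_; 0ℚ; 1ℚ; _+_; _*_; -_)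
open import Data.Rational.Properties using (+-*-ring)
open import Algebra.Module.Bundles using (LeftModule)

natℚ : ℕ → ℚ
natℚ n = + n / 1

sgn : ℕ → ℚ
sgn zero    = 1ℚ
sgn (suc n) = - sgn n

-- recip n = 1/n for n ≥ 1 (only ever used with n ≥ 1); recip 0 = 0 by convention
recip : ℕ → ℚ
recip zero    = 0ℚ
recip (suc k) = + 1 / suc k

H : ℕ → ℚ
H zero    = 0ℚ
H (suc k) = H k + recip (suc k)

-- Everything below works in an arbitrary ℚ-vector space M (e.g. ℂ).
module _ {m ℓ : Level} (M : LeftModule +-*-ring m ℓ) where
  open LeftModule M

  Σᴹ : ℕ → (ℕ → Carrierᴹ) → Carrierᴹ
  Σᴹ zero    f = 0ᴹ
  Σᴹ (suc n) f = Σᴹ n f +ᴹ f n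

  binomD : (ℕ → Carrierᴹ) → ℕ → Carrierᴹ
  binomD c n = Σᴹ (suc n) (λ k → (natℚ (n C k) * sgn (n ∸ k)) *ₗ c k)

module Submission where

open import Defs
open import Data.Nat using (ℕ; suc; _∸_; _≥_)
open import Data.Nat.Combinatorics using (_C_)
open import Data.Rational using (_*_; -_)
open import Data.Rational.Properties using (+-*-ring)
open import Algebra.Module.Bundles using (LeftModule)

open import Level using (Level)
open import Function using (_∘_)
open import Data.Nat as ℕ using (zero; _≤_; _<_; _≤′_; ≤′-refl; ≤′-step)
import Data.Nat.Properties as ℕP
open import Data.Nat.Combinatorics using (nCk+nC[k+1]≡[n+1]C[k+1]; nC1≡n; k>n⇒nCk≡0)
open import Data.Nat.Coprimality using (1-coprimeTo; sym)
open import Data.Integer as ℤ using (+_)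
import Data.Integer.Properties as ℤP
open import Data.Rational using (ℚ; mkℚ; 0ℚ; 1ℚ; _+_; _-_)
open import Data.Rational.Properties
  using (normalize-coprime; /-cong; *-inverseˡ; *-zeroˡ; *-zeroʳ; *-identityˡ; *-identityʳ;
         +-identityˡ; +-identityʳ; +-inverseʳ; neg-distribˡ-*)
open import Data.Rational.Solver using (module +-*-Solver)
open import Algebra.Bundles using (CommutativeMonoid)
import Algebra.Module.Construct.TensorUnit as TensorUnit
open import Relation.Binary.PropositionalEquality using (_≡_; refl; cong; cong₂; trans; module ≡-Reasoning)
import Relation.Binary.PropositionalEquality as Eq
open import Relation.Nullary using (yes; no)

open +-*-Solver using (solve; _:+_; _:-_; _:*_; :-_; _:=_; con)

-- Write e(j,k) = C(j,k)(-1)^(j-k) for the entries of the inverse binomial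
-- matrix, so that d_j = Σ_{k ≤ j} e(j,k) c_k.  Expanding the right-hand side
-- of the corollary in terms of the c_k, the coefficient of c_k is
--   -(-1)^n H_n e(n,k) + Σ_{j<n} (-1)^j e(j,k) / (n-j),
-- and since (-1)^j e(j,k) = (-1)^k C(j,k) the sum is (-1)^k Σ_{j<n} C(j,k)/(n-j).
-- The heart of the proof is the harmonic identity
--   Σ_{j<n} C(j,k)/(n-j) = C(n,k) (H_n - H_k),
-- proved by induction on n and k from Pascal's rule and the absorption
-- identity (k+1) C(n+1,k+1) = (n+1) C(n,k).  With it the coefficient of c_k
-- collapses to -(-1)^k C(n,k) H_k, which is the left-hand side.

-- natℚ n in normal form; this is what makes the operations on it compute.
natℚ-mkℚ : ∀ n → natℚ n ≡ mkℚ (+ n) 0 (sym (1-coprimeTo n))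
natℚ-mkℚ n = normalize-coprime (sym (1-coprimeTo n))

natℚ-+ : ∀ a b → natℚ (a ℕ.+ b) ≡ natℚ a + natℚ b
natℚ-+ a b = trans (/-cong numerators refl) (Eq.sym (cong₂ _+_ (natℚ-mkℚ a) (natℚ-mkℚ b)))
  where
  numerators : + (a ℕ.+ b) ≡ + a ℤ.* + 1 ℤ.+ + b ℤ.* + 1
  numerators = trans (ℤP.pos-+ a b)
    (Eq.sym (cong₂ ℤ._+_ (ℤP.*-identityʳ (+ a)) (ℤP.*-identityʳ (+ b))))

natℚ-* : ∀ a b → natℚ (a ℕ.* b) ≡ natℚ a * natℚ b
natℚ-* a b = trans (/-cong (ℤP.pos-* a b) refl) (Eq.sym (cong₂ _*_ (natℚ-mkℚ a) (natℚ-mkℚ b)))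

recip-inverse : ∀ k → recip (suc k) * natℚ (suc k) ≡ 1ℚ
recip-inverse k =
  trans (cong₂ _*_ (normalize-coprime (1-coprimeTo (suc k))) (natℚ-mkℚ (suc k)))
        (*-inverseˡ (mkℚ (+ suc k) 0 (sym (1-coprimeTo (suc k)))))

sgn-+ : ∀ a b → sgn (a ℕ.+ b) ≡ sgn a * sgn b
sgn-+ zero    b = Eq.sym (*-identityˡ (sgn b))
sgn-+ (suc a) b = trans (cong -_ (sgn-+ a b)) (neg-distribˡ-* (sgn a) (sgn b))

-- ((-1)^a)^2 = 1, in the form in which it is used: multiplying twice by (-1)^a cancels.
sgn-cancel : ∀ a x → sgn a * (sgn a * x) ≡ x
sgn-cancel zero    x = trans (*-identityˡ _) (*-identityˡ x)
sgn-cancel (suc a) x =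
  trans (solve 2 (λ s x → (:- s) :* ((:- s) :* x) := s :* (s :* x)) refl (sgn a) x) (sgn-cancel a x)

sgn-∸ : ∀ {k j} → k ≤ j → sgn (j ∸ k) ≡ sgn j * sgn k
sgn-∸ {k} {j} k≤j = begin
  sgn (j ∸ k)                         ≡⟨ sgn-cancel k (sgn (j ∸ k)) ⟨
  sgn k * (sgn k * sgn (j ∸ k))       ≡⟨ cong (sgn k *_) (sgn-+ k (j ∸ k)) ⟨
  sgn k * sgn (k ℕ.+ (j ∸ k))         ≡⟨ cong (λ i → sgn k * sgn i) (ℕP.m+[n∸m]≡n k≤j) ⟩
  sgn k * sgn j                       ≡⟨ solve 2 (λ a b → a :* b := b :* a) refl (sgn k) (sgn j) ⟩
  sgn j * sgn k                       ∎
  where open ≡-Reasoning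

-- C(n,0) = 1 (not definitional for a variable n).
C-zero : ∀ n → n C 0 ≡ 1
C-zero zero    = refl
C-zero (suc n) = refl

C-absorption : ∀ n k → suc k ℕ.* (suc n C suc k) ≡ suc n ℕ.* (n C k)
C-absorption zero    zero    = refl
C-absorption zero    (suc k) = ℕP.*-zeroʳ (suc (suc k))
C-absorption (suc n) zero    =
  trans (ℕP.*-identityˡ _) (trans (nC1≡n (suc (suc n))) (Eq.sym (ℕP.*-identityʳ _)))
C-absorption (suc n) (suc k) = begin
  suc (suc k) ℕ.* (suc (suc n) C suc (suc k))        ≡⟨ cong (suc (suc k) ℕ.*_) (nCk+nC[k+1]≡[n+1]C[k+1] (suc n) (suc k)) ⟨
  suc (suc k) ℕ.* (X ℕ.+ Y)                          ≡⟨ ℕP.*-distribˡ-+ (suc (suc k)) X Y ⟩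
  (X ℕ.+ suc k ℕ.* X) ℕ.+ suc (suc k) ℕ.* Y          ≡⟨ ℕP.+-assoc X (suc k ℕ.* X) _ ⟩
  X ℕ.+ (suc k ℕ.* X ℕ.+ suc (suc k) ℕ.* Y)          ≡⟨ cong (X ℕ.+_) (cong₂ ℕ._+_ (C-absorption n k) (C-absorption n (suc k))) ⟩
  X ℕ.+ (suc n ℕ.* (n C k) ℕ.+ suc n ℕ.* (n C suc k)) ≡⟨ cong (X ℕ.+_) (ℕP.*-distribˡ-+ (suc n) (n C k) _) ⟨
  X ℕ.+ suc n ℕ.* (n C k ℕ.+ n C suc k)              ≡⟨ cong (λ z → X ℕ.+ suc n ℕ.* z) (nCk+nC[k+1]≡[n+1]C[k+1] n k) ⟩
  X ℕ.+ suc n ℕ.* X                                  ∎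
  where
  open ≡-Reasoning
  X Y : ℕ
  X = suc n C suc k
  Y = suc n C suc (suc k)

C-absorptionℚ : ∀ n k → natℚ (n C k) * recip (suc k) ≡ natℚ (suc n C suc k) * recip (suc n)
C-absorptionℚ n k = begin
  X * rk                  ≡⟨ *-identityʳ _ ⟨
  (X * rk) * 1ℚ           ≡⟨ cong ((X * rk) *_) (recip-inverse n) ⟨
  (X * rk) * (rn * nn)    ≡⟨ solve 4 (λ x rk rn nn → x :* rk :* (rn :* nn) := (nn :* x) :* rn :* rk) refl X rk rn nn ⟩
  (nn * X) * rn * rk      ≡⟨ cong (λ z → z * rn * rk) nn*X≡nk*Z ⟩
  (nk * Z) * rn * rk      ≡⟨ solve 4 (λ z rk rn nk → nk :* z :* rn :* rk := (z :* rn) :* (rk :* nk)) refl Z rk rn nk ⟩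
  (Z * rn) * (rk * nk)    ≡⟨ cong ((Z * rn) *_) (recip-inverse k) ⟩
  (Z * rn) * 1ℚ           ≡⟨ *-identityʳ _ ⟩
  Z * rn                  ∎
  where
  open ≡-Reasoning
  X Z rk rn nn nk : ℚ
  X  = natℚ (n C k)
  Z  = natℚ (suc n C suc k)
  rk = recip (suc k)
  rn = recip (suc n)
  nn = natℚ (suc n)
  nk = natℚ (suc k)
  nn*X≡nk*Z : nn * X ≡ nk * Z
  nn*X≡nk*Z = begin
    nn * X                           ≡⟨ natℚ-* (suc n) (n C k) ⟨
    natℚ (suc n ℕ.* (n C k))         ≡⟨ cong natℚ (C-absorption n k) ⟨
    natℚ (suc k ℕ.* (suc n C suc k)) ≡⟨ natℚ-* (suc k) (suc n C suc k) ⟩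
    nk * Z                           ∎

signedBinomial : ℕ → ℕ → ℚ
signedBinomial j k = natℚ (j C k) * sgn (j ∸ k)

-- e(j,k) = (-1)^j (-1)^k C(j,k) for all j, k (both sides vanish when k > j).
signedBinomial-sign : ∀ j k → signedBinomial j k ≡ (sgn j * sgn k) * natℚ (j C k)
signedBinomial-sign j k with k ℕ.≤? j
... | yes k≤j = trans (cong (natℚ (j C k) *_) (sgn-∸ k≤j))
                      (solve 2 (λ c s → c :* s := s :* c) refl (natℚ (j C k)) (sgn j * sgn k))
... | no  k≰j rewrite k>n⇒nCk≡0 (ℕP.≰⇒> k≰j) =
  solve 2 (λ s t → con 0ℚ :* s := t :* con 0ℚ) refl (sgn (j ∸ k)) (sgn j * sgn k)

-- ℚ as a module over itself; its sums are the sums of rationals.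
ℚ-module : LeftModule +-*-ring _ _
ℚ-module = TensorUnit.leftModule

Σℚ : ℕ → (ℕ → ℚ) → ℚ
Σℚ = Σᴹ ℚ-module

module FiniteSums {m ℓ : Level} (M : LeftModule +-*-ring m ℓ) where
  open LeftModule M
  open import Relation.Binary.Reasoning.Setoid ≈ᴹ-setoid
  open import Algebra.Properties.CommutativeSemigroup
    (CommutativeMonoid.commutativeSemigroup +ᴹ-commutativeMonoid) using (interchange)

  Σ : ℕ → (ℕ → Carrierᴹ) → Carrierᴹ
  Σ = Σᴹ M

  Σ-cong : ∀ n {f g : ℕ → Carrierᴹ} → (∀ i → i < n → f i ≈ᴹ g i) → Σ n f ≈ᴹ Σ n g
  Σ-cong zero    f≈g = ≈ᴹ-refl
  Σ-cong (suc n) f≈g = +ᴹ-cong (Σ-cong n (λ i i<n → f≈g i (ℕP.m<n⇒m<1+n i<n))) (f≈g n (ℕP.n<1+n n))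

  Σ-+ : ∀ n (f g : ℕ → Carrierᴹ) → Σ n (λ i → f i +ᴹ g i) ≈ᴹ Σ n f +ᴹ Σ n g
  Σ-+ zero    f g = ≈ᴹ-sym (+ᴹ-identityˡ 0ᴹ)
  Σ-+ (suc n) f g = ≈ᴹ-trans (+ᴹ-congʳ (Σ-+ n f g)) (interchange _ _ _ _)

  Σ-*ₗ : ∀ n a (f : ℕ → Carrierᴹ) → Σ n (λ i → a *ₗ f i) ≈ᴹ a *ₗ Σ n f
  Σ-*ₗ zero    a f = ≈ᴹ-sym (*ₗ-zeroʳ a)
  Σ-*ₗ (suc n) a f = ≈ᴹ-trans (+ᴹ-congʳ (Σ-*ₗ n a f)) (≈ᴹ-sym (*ₗ-distribˡ a _ _))

  Σ-scalars : ∀ n (a : ℕ → ℚ) x → Σ n (λ j → a j *ₗ x) ≈ᴹ Σℚ n a *ₗ x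
  Σ-scalars zero    a x = ≈ᴹ-sym (*ₗ-zeroˡ x)
  Σ-scalars (suc n) a x = ≈ᴹ-trans (+ᴹ-congʳ (Σ-scalars n a x)) (≈ᴹ-sym (*ₗ-distribʳ x _ _))

  Σ-zero : ∀ n → Σ n (λ _ → 0ᴹ) ≈ᴹ 0ᴹ
  Σ-zero zero    = ≈ᴹ-refl
  Σ-zero (suc n) = ≈ᴹ-trans (+ᴹ-identityʳ _) (Σ-zero n)

  Σ-swap : ∀ n k (F : ℕ → ℕ → Carrierᴹ) →
    Σ n (λ j → Σ k (F j)) ≈ᴹ Σ k (λ i → Σ n (λ j → F j i))
  Σ-swap zero    k F = ≈ᴹ-sym (Σ-zero k)
  Σ-swap (suc n) k F = ≈ᴹ-trans (+ᴹ-congʳ (Σ-swap n k F)) (≈ᴹ-sym (Σ-+ k _ _))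

  Σ-shift : ∀ n (f : ℕ → Carrierᴹ) → Σ (suc n) f ≈ᴹ f 0 +ᴹ Σ n (f ∘ suc)
  Σ-shift zero    f = +ᴹ-comm 0ᴹ (f 0)
  Σ-shift (suc n) f = ≈ᴹ-trans (+ᴹ-congʳ (Σ-shift n f)) (+ᴹ-assoc (f 0) _ _)

  Σ-vanishing-tail : ∀ {m N} (f : ℕ → Carrierᴹ) → m ≤ N →
    (∀ i → m ≤ i → f i ≈ᴹ 0ᴹ) → Σ N f ≈ᴹ Σ m f
  Σ-vanishing-tail {m} f m≤N f≈0 = go (ℕP.≤⇒≤′ m≤N)
    where
    go : ∀ {N} → m ≤′ N → Σ N f ≈ᴹ Σ m f
    go ≤′-refl                  = ≈ᴹ-refl
    go {suc N} (≤′-step m≤′N) =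
      ≈ᴹ-trans (+ᴹ-congˡ (f≈0 N (ℕP.≤′⇒≤ m≤′N))) (≈ᴹ-trans (+ᴹ-identityʳ _) (go m≤′N))

  *ₗ-Σ : ∀ N a (x : ℕ → ℚ) (c : ℕ → Carrierᴹ) →
    a *ₗ Σ N (λ k → x k *ₗ c k) ≈ᴹ Σ N (λ k → (a * x k) *ₗ c k)
  *ₗ-Σ N a x c = ≈ᴹ-sym (≈ᴹ-trans (Σ-cong N (λ k _ → *ₗ-assoc a (x k) (c k))) (Σ-*ₗ N a _))

  Σ-combine : ∀ N (x y : ℕ → ℚ) (c : ℕ → Carrierᴹ) →
    Σ N (λ k → x k *ₗ c k) +ᴹ Σ N (λ k → y k *ₗ c k) ≈ᴹ Σ N (λ k → (x k + y k) *ₗ c k)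
  Σ-combine N x y c =
    ≈ᴹ-sym (≈ᴹ-trans (Σ-cong N (λ k _ → *ₗ-distribʳ (c k) (x k) (y k))) (Σ-+ N _ _))

  Σ-rows : ∀ n N (b : ℕ → ℚ) (E : ℕ → ℕ → ℚ) (c : ℕ → Carrierᴹ) →
    Σ n (λ j → b j *ₗ Σ N (λ k → E j k *ₗ c k)) ≈ᴹ Σ N (λ k → Σℚ n (λ j → b j * E j k) *ₗ c k)
  Σ-rows n N b E c = begin
    Σ n (λ j → b j *ₗ Σ N (λ k → E j k *ₗ c k))   ≈⟨ Σ-cong n (λ j _ → *ₗ-Σ N (b j) (E j) c) ⟩
    Σ n (λ j → Σ N (λ k → (b j * E j k) *ₗ c k))  ≈⟨ Σ-swap n N _ ⟩
    Σ N (λ k → Σ n (λ j → (b j * E j k) *ₗ c k))  ≈⟨ Σ-cong N (λ k _ → Σ-scalars n _ (c k)) ⟩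
    Σ N (λ k → Σℚ n (λ j → b j * E j k) *ₗ c k)   ∎

module ℚSums = FiniteSums ℚ-module

harmonicSum : ℕ → ℕ → ℚ
harmonicSum n k = Σℚ n (λ j → recip (n ∸ j) * natℚ (j C k))

-- Splitting off j = 0 (note recip ((n+1) ∸ (j+1)) = recip (n ∸ j)).
harmonicSum-split : ∀ n k →
  harmonicSum (suc n) k ≡ recip (suc n) * natℚ (0 C k) + Σℚ n (λ j → recip (n ∸ j) * natℚ (suc j C k))
harmonicSum-split n k = ℚSums.Σ-shift n (λ j → recip (suc n ∸ j) * natℚ (j C k))

harmonicSum-zero-step : ∀ n → harmonicSum (suc n) 0 ≡ recip (suc n) + harmonicSum n 0
harmonicSum-zero-step n = trans (harmonicSum-split n 0)
  (cong₂ _+_ (*-identityʳ (recip (suc n)))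
             (ℚSums.Σ-cong n (λ j _ → cong (λ z → recip (n ∸ j) * natℚ z)
                                            (trans (C-zero (suc j)) (Eq.sym (C-zero j))))))

-- Pascal's rule lifted to the sums.
harmonicSum-suc-step : ∀ n k → harmonicSum (suc n) (suc k) ≡ harmonicSum n k + harmonicSum n (suc k)
harmonicSum-suc-step n k = begin
  harmonicSum (suc n) (suc k)
    ≡⟨ harmonicSum-split n (suc k) ⟩
  recip (suc n) * 0ℚ + Σℚ n (λ j → recip (n ∸ j) * natℚ (suc j C suc k))
    ≡⟨ cong₂ _+_ (*-zeroʳ (recip (suc n))) (ℚSums.Σ-cong n (λ j _ → pascal j)) ⟩
  0ℚ + Σℚ n (λ j → recip (n ∸ j) * natℚ (j C k) + recip (n ∸ j) * natℚ (j C suc k))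
    ≡⟨ +-identityˡ _ ⟩
  Σℚ n (λ j → recip (n ∸ j) * natℚ (j C k) + recip (n ∸ j) * natℚ (j C suc k))
    ≡⟨ ℚSums.Σ-+ n _ _ ⟩
  harmonicSum n k + harmonicSum n (suc k) ∎
  where
  open ≡-Reasoning
  pascal : ∀ j → recip (n ∸ j) * natℚ (suc j C suc k)
               ≡ recip (n ∸ j) * natℚ (j C k) + recip (n ∸ j) * natℚ (j C suc k)
  pascal j = trans (cong (λ z → recip (n ∸ j) * natℚ z) (Eq.sym (nCk+nC[k+1]≡[n+1]C[k+1] j k)))
    (trans (cong (recip (n ∸ j) *_) (natℚ-+ (j C k) (j C suc k)))
           (solve 3 (λ r x y → r :* (x :+ y) := r :* x :+ r :* y) refl (recip (n ∸ j)) (natℚ (j C k)) (natℚ (j C suc k))))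

-- The algebra of the inductive step: with X = C(n,k), Y = C(n,k+1) and the
-- absorption identity X/(k+1) = (X+Y)/(n+1), the two inductive hypotheses
-- combine into the claim for (n+1, k+1).
harmonic-step-algebra : ∀ X Y h hk rk rn → X * rk ≡ (X + Y) * rn →
  X * (h - hk) + Y * (h - (hk + rk)) ≡ (X + Y) * ((h + rn) - (hk + rk))
harmonic-step-algebra X Y h hk rk rn absorb = begin
  X * (h - hk) + Y * (h - (hk + rk))
    ≡⟨ solve 6 (λ X Y h hk rk rn → X :* (h :- hk) :+ Y :* (h :- (hk :+ rk))
                  := (X :+ Y) :* ((h :+ rn) :- (hk :+ rk)) :+ (X :* rk :- (X :+ Y) :* rn))
               refl X Y h hk rk rn ⟩
  (X + Y) * ((h + rn) - (hk + rk)) + (X * rk - (X + Y) * rn)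
    ≡⟨ cong (λ z → (X + Y) * ((h + rn) - (hk + rk)) + (z - (X + Y) * rn)) absorb ⟩
  (X + Y) * ((h + rn) - (hk + rk)) + ((X + Y) * rn - (X + Y) * rn)
    ≡⟨ cong (λ z → (X + Y) * ((h + rn) - (hk + rk)) + z) (+-inverseʳ ((X + Y) * rn)) ⟩
  (X + Y) * ((h + rn) - (hk + rk)) + 0ℚ
    ≡⟨ +-identityʳ _ ⟩
  (X + Y) * ((h + rn) - (hk + rk)) ∎
  where open ≡-Reasoning

harmonicSum-closed : ∀ n k → harmonicSum n k ≡ natℚ (n C k) * (H n - H k)
harmonicSum-closed zero    zero    = refl
harmonicSum-closed zero    (suc k) = Eq.sym (*-zeroˡ (H 0 - H (suc k)))
harmonicSum-closed (suc n) zero    =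
  trans (harmonicSum-zero-step n)
    (trans (cong (λ z → recip (suc n) + z) (harmonicSum-closed n 0))
           (solve 2 (λ r h → r :+ con 1ℚ :* (h :- con 0ℚ) := con 1ℚ :* ((h :+ r) :- con 0ℚ))
                  refl (recip (suc n)) (H n)))
harmonicSum-closed (suc n) (suc k) =
  trans (harmonicSum-suc-step n k)
    (trans (cong₂ _+_ (harmonicSum-closed n k) (harmonicSum-closed n (suc k)))
      (trans (harmonic-step-algebra X Y (H n) (H k) (recip (suc k)) (recip (suc n))
                (trans (C-absorptionℚ n k) (cong (_* recip (suc n)) pascal)))
             (cong (_* ((H n + recip (suc n)) - (H k + recip (suc k)))) (Eq.sym pascal))))
  where
  X Y : ℚ
  X = natℚ (n C k)
  Y = natℚ (n C suc k)
  pascal : natℚ (suc n C suc k) ≡ X + Y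
  pascal = trans (cong natℚ (Eq.sym (nCk+nC[k+1]≡[n+1]C[k+1] n k))) (natℚ-+ (n C k) (n C suc k))

coefficient-identity : ∀ n k →
  natℚ (n C k) * ((- sgn k) * H k)
    ≡ ((- sgn n) * H n) * signedBinomial n k
      + Σℚ n (λ j → (sgn j * recip (n ∸ j)) * signedBinomial j k)
coefficient-identity n k = Eq.sym (begin
  ((- sn) * H n) * signedBinomial n k + Σℚ n (λ j → (sgn j * recip (n ∸ j)) * signedBinomial j k)
    ≡⟨ cong₂ _+_ leading-term (ℚSums.Σ-cong n (λ j _ → row-term j)) ⟩
  (- (sk * Cnk * H n)) + Σℚ n (λ j → sk * (recip (n ∸ j) * natℚ (j C k)))
    ≡⟨ cong (λ z → (- (sk * Cnk * H n)) + z) (ℚSums.Σ-*ₗ n sk _) ⟩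
  (- (sk * Cnk * H n)) + sk * harmonicSum n k
    ≡⟨ cong (λ z → (- (sk * Cnk * H n)) + sk * z) (harmonicSum-closed n k) ⟩
  (- (sk * Cnk * H n)) + sk * (Cnk * (H n - H k))
    ≡⟨ solve 4 (λ c s h hk → (:- (s :* c :* h)) :+ s :* (c :* (h :- hk)) := c :* ((:- s) :* hk))
             refl Cnk sk (H n) (H k) ⟩
  Cnk * ((- sk) * H k) ∎)
  where
  open ≡-Reasoning
  Cnk sn sk : ℚ
  Cnk = natℚ (n C k)
  sn  = sgn n
  sk  = sgn k
  leading-term : ((- sn) * H n) * signedBinomial n k ≡ - (sk * Cnk * H n)
  leading-term = begin
    ((- sn) * H n) * signedBinomial n k ≡⟨ cong (((- sn) * H n) *_) (signedBinomial-sign n k) ⟩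
    ((- sn) * H n) * ((sn * sk) * Cnk)  ≡⟨ solve 4 (λ s t c h → ((:- s) :* h) :* ((s :* t) :* c)
                                                     := s :* (s :* (:- (t :* c :* h)))) refl sn sk Cnk (H n) ⟩
    sn * (sn * (- (sk * Cnk * H n)))    ≡⟨ sgn-cancel n _ ⟩
    - (sk * Cnk * H n)                  ∎
  row-term : ∀ j → (sgn j * recip (n ∸ j)) * signedBinomial j k ≡ sk * (recip (n ∸ j) * natℚ (j C k))
  row-term j = begin
    (sgn j * r) * signedBinomial j k    ≡⟨ cong ((sgn j * r) *_) (signedBinomial-sign j k) ⟩
    (sgn j * r) * ((sgn j * sk) * Cj)   ≡⟨ solve 4 (λ s t r c → (s :* r) :* ((s :* t) :* c)
                                                     := s :* (s :* (t :* (r :* c)))) refl (sgn j) sk r Cj ⟩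
    sgn j * (sgn j * (sk * (r * Cj)))   ≡⟨ sgn-cancel j _ ⟩
    sk * (r * Cj)                       ∎
    where
    r Cj : ℚ
    r  = recip (n ∸ j)
    Cj = natℚ (j C k)

module BinomialTransform {m ℓ : Level} (M : LeftModule +-*-ring m ℓ) where
  open LeftModule M
  open FiniteSums M

  -- d_j written as a sum over the fixed range k < N, for any j < N: the terms
  -- with k > j vanish since C(j,k) = 0.  This puts all d_j, j ≤ n, on a common range.
  binomD-padded : ∀ (c : ℕ → Carrierᴹ) {j N} → j < N →
    binomD M c j ≈ᴹ Σ N (λ k → signedBinomial j k *ₗ c k)
  binomD-padded c {j} j<N = ≈ᴹ-sym (Σ-vanishing-tail _ j<N beyond-j)
    where
    beyond-j : ∀ k → j < k → signedBinomial j k *ₗ c k ≈ᴹ 0ᴹ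
    beyond-j k j<k rewrite k>n⇒nCk≡0 j<k =
      ≈ᴹ-trans (*ₗ-cong (*-zeroˡ (sgn (j ∸ k))) ≈ᴹ-refl) (*ₗ-zeroˡ (c k))

-- Both sides are linear combinations of c_0, ..., c_n; after expanding each
-- d_j over k ≤ n and exchanging the summations, their coefficients agree by
-- the coefficient identity.
corollary3 : ∀ {m ℓ} (M : LeftModule +-*-ring m ℓ) (c : ℕ → LeftModule.Carrierᴹ M) (n : ℕ) → n ≥ 1 →
    LeftModule._≈ᴹ_ M
      (Σᴹ M (suc n) (λ k → LeftModule._*ₗ_ M (natℚ (n C k) * ((- sgn k) * H k)) (c k)))
      (LeftModule._+ᴹ_ M
        (LeftModule._*ₗ_ M ((- sgn n) * H n) (binomD M c n))
        (Σᴹ M n (λ j → LeftModule._*ₗ_ M (sgn j * recip (n ∸ j)) (binomD M c j))))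
corollary3 M c n _ = begin
  Σ N (λ k → (natℚ (n C k) * ((- sgn k) * H k)) *ₗ c k)
    ≈⟨ Σ-cong N (λ k _ → *ₗ-cong (coefficient-identity n k) ≈ᴹ-refl) ⟩
  Σ N (λ k → (A * e n k + Σℚ n (λ j → b j * e j k)) *ₗ c k)
    ≈⟨ Σ-combine N _ _ c ⟨
  Σ N (λ k → (A * e n k) *ₗ c k) +ᴹ Σ N (λ k → Σℚ n (λ j → b j * e j k) *ₗ c k)
    ≈⟨ +ᴹ-cong (*ₗ-Σ N A (e n) c) (Σ-rows n N b e c) ⟨
  A *ₗ Σ N (λ k → e n k *ₗ c k) +ᴹ Σ n (λ j → b j *ₗ Σ N (λ k → e j k *ₗ c k))
    ≈⟨ +ᴹ-cong (*ₗ-congˡ (binomD-padded c (ℕP.n<1+n n)))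
               (Σ-cong n (λ j j<n → *ₗ-congˡ (binomD-padded c (ℕP.m<n⇒m<1+n j<n)))) ⟨
  A *ₗ binomD M c n +ᴹ Σ n (λ j → b j *ₗ binomD M c j) ∎
  where
  open LeftModule M
  open FiniteSums M
  open BinomialTransform M
  open import Relation.Binary.Reasoning.Setoid ≈ᴹ-setoid
  N : ℕ
  N = suc n
  A : ℚ
  A = (- sgn n) * H n
  e : ℕ → ℕ → ℚ
  e = signedBinomial
  b : ℕ → ℚ
  b j = sgn j * recip (n ∸ j)
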